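{- Let $k \geq 0$, let $G$ be a cubic graph, and let $G_c$ be the $k$-core of $G$ with respect to three pairwise different 1-factors $M_1, M_2, M_3$ (so $|E(G) - (M_1\cup M_2\cup M_3)| = k$). Then (1) if $k < 3$, then $G$ is 3-edge-colorable; (2) $|V(G_c)| = 2k - 2|M_1 \cap M_2 \cap M_3|$ and $|E(G_c)| = 2k - |M_1 \cap M_2 \cap M_3|$; (3) $\mathrm{girth}(G_c) \leq 2k$; (4) $G_c$ has at most $2k/\mathrm{girth}(G_c)$ components.
   Context: Graphs are finite, may have parallel edges, but no loops. A 1-factor is a spanning 1-regular subgraph, identified with its edge set. For $X \subseteq E(G)$, $G[X]$ is the graph with edge set $X$ and vertex set all endpoints of edges of $X$. For three pairwise different 1-factors $M_1,M_2,M_3$ of a cubic graph $G$, let $\mathcal{M} = \bigcup_{i \neq j}(M_i \cap M_j)$ and $\mathcal{U} = E(G) - (M_1 \cup M_2 \cup M_3)$; if $|\mathcal{U}| = k$, then $G[\mathcal{M} \cup \mathcal{U}]$ is the $k$-core of $G$ with respect to $M_1,M_2,M_3$. The girth of a graph is the length of a shortest circuit (two parallel edges form a circuit of length 2). -}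

module Defs where

open import Data.Nat using (ℕ; zero; suc; _+_; _*_; _≤_; _≤?_)
open import Data.Bool using (Bool; true; false; _∨_)
open import Data.Fin using (Fin; zero; suc; inject₁; fromℕ) renaming (_≟_ to _≟ᶠ_)
open import Data.Fin.Subset using (Subset; _∈_; _∩_; _∪_; ∁; ∣_∣)
open import Data.Vec using (tabulate)
open import Data.Product using (Σ; _×_; _,_; proj₁; proj₂)
open import Data.Sum using (_⊎_)
open import Relation.Binary.PropositionalEquality using (_≡_; _≢_)
open import Relation.Nullary using (¬_)
open import Relation.Nullary.Decidable using (⌊_⌋)
open import Function.Definitions using (Injective)

record Multigraph : Set where
  field
    n        : ℕ
    m        : ℕ
    ends     : Fin m → Fin n × Fin n
    loopless : ∀ e → proj₁ (ends e) ≢ proj₂ (ends e)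

module _ (G : Multigraph) where
  open Multigraph G

  EdgeSet : Set
  EdgeSet = Subset m

  VertexSet : Set
  VertexSet = Subset n

  inc : Fin m → Fin n → Bool
  inc e v = ⌊ proj₁ (ends e) ≟ᶠ v ⌋ ∨ ⌊ proj₂ (ends e) ≟ᶠ v ⌋

  incSet : Fin n → EdgeSet
  incSet v = tabulate (λ e → inc e v)

  Joins : Fin m → Fin n → Fin n → Set
  Joins e x y = (proj₁ (ends e) ≡ x × proj₂ (ends e) ≡ y)
              ⊎ (proj₁ (ends e) ≡ y × proj₂ (ends e) ≡ x)

  Cubic : Set
  Cubic = ∀ v → ∣ incSet v ∣ ≡ 3

  IsOneFactor : EdgeSet → Set
  IsOneFactor M = ∀ v → ∣ M ∩ incSet v ∣ ≡ 1

  ThreeEdgeColorable : Set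
  ThreeEdgeColorable =
    Σ (Fin m → Fin 3) λ c →
      ∀ e f v → e ≢ f → inc e v ≡ true → inc f v ≡ true → c e ≢ c f

  -- vertex set of G[X]: endpoints of edges of X
  verticesOf : EdgeSet → VertexSet
  verticesOf X = tabulate (λ v → ⌊ 1 ≤? ∣ X ∩ incSet v ∣ ⌋)

  record Circuit (X : EdgeSet) (ℓ : ℕ) : Set where
    field
      two≤ℓ   : 2 ≤ ℓ
      vtx     : Fin (suc ℓ) → Fin n
      edg     : Fin ℓ → Fin m
      closed  : vtx (fromℕ ℓ) ≡ vtx zero
      inX     : ∀ i → edg i ∈ X
      joins   : ∀ i → Joins (edg i) (vtx (inject₁ i)) (vtx (suc i))
      vtxInj  : Injective _≡_ _≡_ (λ i → vtx (inject₁ i))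
      edgInj  : Injective _≡_ _≡_ edg

  IsGirth : EdgeSet → ℕ → Set
  IsGirth X g = Circuit X g × (∀ ℓ → Circuit X ℓ → g ≤ ℓ)

  data Reach (X : EdgeSet) : Fin n → Fin n → Set where
    here : ∀ {v} → Reach X v v
    step : ∀ {u w v} e → e ∈ X → Joins e u w → Reach X w v → Reach X u v

  HasComponents : EdgeSet → ℕ → Set
  HasComponents X c =
    Σ (Fin c → Fin n) λ r →
      (∀ i → r i ∈ verticesOf X)
      × (∀ i j → i ≢ j → ¬ Reach X (r i) (r j))
      × (∀ v → v ∈ verticesOf X → Σ (Fin c) λ i → Reach X v (r i))

  multiplyCovered : EdgeSet → EdgeSet → EdgeSet → EdgeSet
  multiplyCovered M₁ M₂ M₃ = ((M₁ ∩ M₂) ∪ (M₁ ∩ M₃)) ∪ (M₂ ∩ M₃)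

  uncovered : EdgeSet → EdgeSet → EdgeSet → EdgeSet
  uncovered M₁ M₂ M₃ = ∁ ((M₁ ∪ M₂) ∪ M₃)

  coreEdges : EdgeSet → EdgeSet → EdgeSet → EdgeSet
  coreEdges M₁ M₂ M₃ = multiplyCovered M₁ M₂ M₃ ∪ uncovered M₁ M₂ M₃

-- At a vertex v let T, D, O, U count the incident edges lying in exactly 3, 2, 1, 0 of the
-- factors. Cubicity gives T + D + O + U = 3 and the factors give 3T + 2D + O = 3, so
-- (T, D, O, U) is (0,0,3,0), (0,1,1,1) or (1,0,0,2). Hence U = D + 2T at every vertex, the core
-- has minimum degree 2 and U − T counts core vertices; double counting (handshake) yields
-- |𝒰| = |D| + 2|T| and both identities of (2), so |V(G_c)| ≤ 2k.
-- If k < 3, either there is no triple edge, |D| ≤ 2 and two of the factors are disjoint (the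
-- remaining edges then form a third 1-factor), or there is exactly one triple edge, no double
-- edge, and a colouring is read off M₁, M₂ and the uncovered edges.
-- A non-backtracking walk in a graph of minimum degree 2 closes a circuit at its first repeated
-- vertex, so every core vertex reaches a circuit. A circuit has at most |V(G_c)| vertices, and
-- different components contain vertex-disjoint circuits of length at least the girth.

module Submission where

open import Defs
open import Data.Bool using (Bool; true; false; _∧_; _∨_; not)
open import Data.Bool.Properties using (∧-conicalˡ; ∧-conicalʳ; ∧-identityʳ; ∨-zeroʳ)
open import Data.Empty using (⊥; ⊥-elim)
open import Data.Fin using (Fin; zero; suc; toℕ; inject₁; inject≤; fromℕ; fromℕ<; combine; remQuot) renaming (_≟_ to _≟ᶠ_)
import Data.Fin.Properties as Fin
open import Data.Fin.Properties using (toℕ-injective; toℕ<n; toℕ-inject₁; toℕ-fromℕ; toℕ-fromℕ<; inject≤-injective; combine-remQuot)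
open import Data.Fin.Subset using (Subset; _∈_; _∩_; _∪_; ∁; ∣_∣)
open import Data.Fin.Subset.Properties using (_∈?_)
open import Data.Nat using (ℕ; zero; suc; _+_; _*_; _∸_; _≤_; _<_; z≤n; s≤s; _≤?_)
open import Data.Nat.Properties
open import Data.Nat.Tactic.RingSolver using (solve-∀)
open import Algebra.Properties.Semiring.Sum +-*-semiring
  using (sum; sum-syntax; sum-cong-≗; ∑-distrib-+; ∑-comm; *-distribʳ-sum; *-distribˡ-sum; sum-replicate-zero)
open import Data.Product using (Σ; _×_; _,_; proj₁; proj₂; uncurry)
open import Data.Sum using (_⊎_; inj₁; inj₂)
open import Data.Vec using ([]; _∷_; lookup)
open import Data.Vec.Properties using (lookup-zipWith; lookup-map; lookup∘tabulate; lookup⇒[]=; []=⇒lookup)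
open import Function using (_∘_)
open import Function.Definitions using (Injective)
open import Relation.Binary using (tri<; tri≈; tri>)
open import Relation.Binary.PropositionalEquality
  using (_≡_; _≢_; refl; sym; trans; cong; cong₂; subst; subst₂; module ≡-Reasoning)
open import Relation.Nullary using (¬_; Dec; yes; no; contradiction)
open import Relation.Nullary.Decidable using (⌊_⌋; map′; _×-dec_; _⊎-dec_; _→-dec_)

isYes-true : ∀ {A : Set} (a? : Dec A) → A → ⌊ a? ⌋ ≡ true
isYes-true (yes _) _ = refl
isYes-true (no ¬a) a = ⊥-elim (¬a a)

isNo-true⁻¹ : ∀ {A : Set} (a? : Dec A) → not ⌊ a? ⌋ ≡ true → ¬ A
isNo-true⁻¹ (no ¬a) _ = ¬a

isYes-true⁻¹ : ∀ {A : Set} (a? : Dec A) → ⌊ a? ⌋ ≡ true → A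
isYes-true⁻¹ (yes a) _ = a

∧-true : ∀ {a b} → a ∧ b ≡ true → a ≡ true × b ≡ true
∧-true {true} b≡t = refl , b≡t

∨-true : ∀ a {b} → a ∨ b ≡ true → a ≡ true ⊎ b ≡ true
∨-true true  _   = inj₁ refl
∨-true false b≡t = inj₂ b≡t

-- Finite sums

𝟙 : Bool → ℕ
𝟙 true  = 1
𝟙 false = 0

𝟙-∧ : ∀ a b → 𝟙 (a ∧ b) ≡ 𝟙 a * 𝟙 b
𝟙-∧ true  b = sym (+-identityʳ (𝟙 b))
𝟙-∧ false b = refl

𝟙≤1 : ∀ b → 𝟙 b ≤ 1
𝟙≤1 true  = ≤-refl
𝟙≤1 false = z≤n

sum-mono-≤ : ∀ {n} {f g : Fin n → ℕ} → (∀ x → f x ≤ g x) → sum f ≤ sum g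
sum-mono-≤ {zero}  f≤g = z≤n
sum-mono-≤ {suc n} f≤g = +-mono-≤ (f≤g zero) (sum-mono-≤ (f≤g ∘ suc))

∑-distrib-+₃ : ∀ {n} (f g h : Fin n → ℕ) → ∑[ x < n ] (f x + g x + h x) ≡ sum f + sum g + sum h
∑-distrib-+₃ f g h = trans (∑-distrib-+ (λ x → f x + g x) h) (cong (_+ sum h) (∑-distrib-+ f g))

sum-zero : ∀ {n} {f : Fin n → ℕ} → (∀ x → f x ≡ 0) → sum f ≡ 0
sum-zero {n} f≡0 = trans (sum-cong-≗ f≡0) (sum-replicate-zero n)

≤-sum : ∀ {n} (f : Fin n → ℕ) a → f a ≤ sum f
≤-sum f zero    = m≤m+n (f zero) _
≤-sum f (suc a) = ≤-trans (≤-sum (f ∘ suc) a) (m≤n+m _ (f zero))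

δ : ∀ {n} → Fin n → Fin n → ℕ
δ a b = 𝟙 ⌊ a ≟ᶠ b ⌋

sum-δ* : ∀ {n} (a : Fin n) (f : Fin n → ℕ) → ∑[ v < n ] (δ a v * f v) ≡ f a
sum-δ* {suc n} zero f = trans (cong (f zero + 0 +_) (sum-zero {n} (λ _ → refl))) (trans (+-identityʳ _) (+-identityʳ (f zero)))
sum-δ* (suc a) f = trans (sum-cong-≗ shift) (sum-δ* a (f ∘ suc))
  where
  shift : ∀ x → δ (suc a) (suc x) * f (suc x) ≡ δ a x * f (suc x)
  shift x with a ≟ᶠ x
  ... | yes _ = refl
  ... | no _  = refl

sum-δ : ∀ {n} (a : Fin n) → sum (δ a) ≡ 1
sum-δ a = trans (sum-cong-≗ (λ v → sym (*-identityʳ (δ a v)))) (sum-δ* a (λ _ → 1))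

sum-𝟙≤1 : ∀ {k} (p : Fin k → Bool) → (∀ i j → p i ≡ true → p j ≡ true → i ≡ j) → sum (𝟙 ∘ p) ≤ 1
sum-𝟙≤1 {zero}  p unique = z≤n
sum-𝟙≤1 {suc k} p unique with p zero in p₀
... | true  = ≤-reflexive (cong suc (sum-zero rest≡0))
  where
  rest≡0 : ∀ x → 𝟙 (p (suc x)) ≡ 0
  rest≡0 x with p (suc x) in pₓ
  ... | true with () ← unique zero (suc x) p₀ pₓ
  ... | false = refl
... | false = sum-𝟙≤1 (p ∘ suc) (λ i j pᵢ pⱼ → Fin.suc-injective (unique (suc i) (suc j) pᵢ pⱼ))

sum-∘-injective : ∀ {k n} (h : Fin k → Fin n) → Injective _≡_ _≡_ h → (f : Fin n → ℕ) → sum (f ∘ h) ≤ sum f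
sum-∘-injective {k} {n} h h-inj f = begin
  ∑[ i < k ] f (h i)                        ≡⟨ sum-cong-≗ (λ i → sym (sum-δ* (h i) f)) ⟩
  ∑[ i < k ] ∑[ v < n ] (δ (h i) v * f v)   ≡⟨ ∑-comm (λ i v → δ (h i) v * f v) ⟩
  ∑[ v < n ] ∑[ i < k ] (δ (h i) v * f v)   ≡⟨ sum-cong-≗ (λ v → sym (*-distribʳ-sum (f v) (λ i → δ (h i) v))) ⟩
  ∑[ v < n ] (sum (λ i → δ (h i) v) * f v)  ≤⟨ sum-mono-≤ (λ v → *-monoˡ-≤ (f v) (sum-𝟙≤1 _ (fibre≤1 v))) ⟩
  ∑[ v < n ] (1 * f v)                      ≡⟨ sum-cong-≗ (λ v → *-identityˡ (f v)) ⟩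
  sum f                                     ∎
  where
  open ≤-Reasoning
  fibre≤1 : ∀ v i j → ⌊ h i ≟ᶠ v ⌋ ≡ true → ⌊ h j ≟ᶠ v ⌋ ≡ true → i ≡ j
  fibre≤1 v i j hᵢ hⱼ with h i ≟ᶠ v | h j ≟ᶠ v
  ... | yes hi≡v | yes hj≡v = h-inj (trans hi≡v (sym hj≡v))

sum-pair≤ : ∀ {n} (f : Fin n → ℕ) a b → a ≢ b → f a + f b ≤ sum f
sum-pair≤ {n} f a b a≢b = subst (_≤ sum f) (cong (f a +_) (+-identityʳ (f b))) (sum-∘-injective h h-inj f)
  where
  h : Fin 2 → Fin n
  h zero       = a
  h (suc zero) = b
  h-inj : Injective _≡_ _≡_ h
  h-inj {zero}     {zero}     _ = refl
  h-inj {zero}     {suc zero} e = ⊥-elim (a≢b e)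
  h-inj {suc zero} {zero}     e = ⊥-elim (a≢b (sym e))
  h-inj {suc zero} {suc zero} _ = refl

sum-triple≤ : ∀ {n} (f : Fin n → ℕ) a b c → a ≢ b → a ≢ c → b ≢ c → f a + f b + f c ≤ sum f
sum-triple≤ {n} f a b c a≢b a≢c b≢c =
  subst (_≤ sum f) (trans (cong (λ z → f a + (f b + z)) (+-identityʳ (f c))) (sym (+-assoc (f a) (f b) (f c))))
    (sum-∘-injective h h-inj f)
  where
  h : Fin 3 → Fin n
  h zero             = a
  h (suc zero)       = b
  h (suc (suc zero)) = c
  h-inj : Injective _≡_ _≡_ h
  h-inj {zero}             {zero}             _ = refl
  h-inj {zero}             {suc zero}         e = ⊥-elim (a≢b e)
  h-inj {zero}             {suc (suc zero)}   e = ⊥-elim (a≢c e)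
  h-inj {suc zero}         {zero}             e = ⊥-elim (a≢b (sym e))
  h-inj {suc zero}         {suc zero}         _ = refl
  h-inj {suc zero}         {suc (suc zero)}   e = ⊥-elim (b≢c e)
  h-inj {suc (suc zero)}   {zero}             e = ⊥-elim (a≢c (sym e))
  h-inj {suc (suc zero)}   {suc zero}         e = ⊥-elim (b≢c (sym e))
  h-inj {suc (suc zero)}   {suc (suc zero)}   _ = refl

1≤sum-𝟙⇒∃ : ∀ {n} (p : Fin n → Bool) → 1 ≤ sum (𝟙 ∘ p) → Σ (Fin n) (λ x → p x ≡ true)
1≤sum-𝟙⇒∃ {suc n} p 1≤∑ with p zero in p₀
... | true  = zero , p₀
... | false with x , pₓ ← 1≤sum-𝟙⇒∃ (p ∘ suc) 1≤∑ = suc x , pₓ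

sum-ones : ∀ {n} → ∑[ x < n ] 1 ≡ n
sum-ones {zero}  = refl
sum-ones {suc n} = cong suc (sum-ones {n})

another-member : ∀ {n} (p : Fin n → Bool) (a : Fin n) → 2 ≤ sum (𝟙 ∘ p) → Σ (Fin n) λ x → x ≢ a × p x ≡ true
another-member {n} p a 2≤∑ =
  let x , qx = 1≤sum-𝟙⇒∃ q 1≤∑q in x , isNo-true⁻¹ (x ≟ᶠ a) (proj₂ (∧-true qx)) , proj₁ (∧-true qx)
  where
  open ≤-Reasoning
  q : Fin n → Bool
  q x = p x ∧ not ⌊ x ≟ᶠ a ⌋
  p≤δ+q : ∀ x → 𝟙 (p x) ≤ δ a x + 𝟙 (q x)
  p≤δ+q x with a ≟ᶠ x | x ≟ᶠ a
  ... | yes _   | yes _   = ≤-trans (𝟙≤1 (p x)) (m≤m+n 1 _)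
  ... | yes a≡x | no  x≢a = contradiction (sym a≡x) x≢a
  ... | no  a≢x | yes x≡a = contradiction (sym x≡a) a≢x
  ... | no  _   | no  _   = ≤-reflexive (cong 𝟙 (sym (∧-identityʳ (p x))))
  1≤∑q : 1 ≤ sum (𝟙 ∘ q)
  1≤∑q = +-cancelˡ-≤ 1 1 _ (begin
    2                              ≤⟨ 2≤∑ ⟩
    sum (𝟙 ∘ p)                    ≤⟨ sum-mono-≤ p≤δ+q ⟩
    ∑[ x < n ] (δ a x + 𝟙 (q x))   ≡⟨ ∑-distrib-+ (δ a) (𝟙 ∘ q) ⟩
    sum (δ a) + sum (𝟙 ∘ q)        ≡⟨ cong (_+ sum (𝟙 ∘ q)) (sum-δ a) ⟩
    1 + sum (𝟙 ∘ q)                ∎)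

module _ {k : ℕ} (p q : Subset k) (x : Fin k) where
  lookup-∩ : lookup (p ∩ q) x ≡ (lookup p x ∧ lookup q x)
  lookup-∩ = lookup-zipWith _∧_ x p q

  lookup-∪ : lookup (p ∪ q) x ≡ (lookup p x ∨ lookup q x)
  lookup-∪ = lookup-zipWith _∨_ x p q

lookup-∁ : ∀ {k} (p : Subset k) x → lookup (∁ p) x ≡ not (lookup p x)
lookup-∁ p x = lookup-map x not p

∣p∣≡sum : ∀ {n} (p : Subset n) → ∣ p ∣ ≡ sum (𝟙 ∘ lookup p)
∣p∣≡sum []           = refl
∣p∣≡sum (true ∷ p)  = cong suc (∣p∣≡sum p)
∣p∣≡sum (false ∷ p) = ∣p∣≡sum p

injection⇒≤∣∣ : ∀ {N k} (p : Subset k) (h : Fin N → Fin k) → Injective _≡_ _≡_ h → (∀ z → lookup p (h z) ≡ true) → N ≤ ∣ p ∣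
injection⇒≤∣∣ {N} p h h-inj h∈p = begin
  N                        ≡⟨ sum-ones ⟨
  ∑[ z < N ] 1             ≡⟨ sum-cong-≗ (cong 𝟙 ∘ h∈p) ⟨
  sum (𝟙 ∘ lookup p ∘ h)   ≤⟨ sum-∘-injective h h-inj (𝟙 ∘ lookup p) ⟩
  sum (𝟙 ∘ lookup p)       ≡⟨ ∣p∣≡sum p ⟨
  ∣ p ∣                    ∎
  where open ≤-Reasoning

-- Least witnesses

leastWitness : {P : ℕ → Set} → (∀ ℓ → Dec (P ℓ)) → ∀ {L} → P L → Σ ℕ λ g → P g × (∀ ℓ → ℓ < g → ¬ P ℓ)
leastWitness {P} P? {L} PL = search L 0 refl (λ _ ())
  where
  search : ∀ fuel s → s + fuel ≡ L → (∀ ℓ → ℓ < s → ¬ P ℓ) → Σ ℕ λ g → P g × (∀ ℓ → ℓ < g → ¬ P ℓ)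
  search zero s s≡L none = s , subst P (sym (trans (sym (+-identityʳ s)) s≡L)) PL , none
  search (suc fuel) s s+fuel≡L none with P? s
  ... | yes Ps = s , Ps , none
  ... | no ¬Ps = search fuel (suc s) (trans (sym (+-suc s fuel)) s+fuel≡L) none′
    where
    none′ : ∀ ℓ → ℓ < suc s → ¬ P ℓ
    none′ ℓ ℓ<s+1 with m≤n⇒m<n∨m≡n (≤-pred ℓ<s+1)
    ... | inj₁ ℓ<s  = none ℓ ℓ<s
    ... | inj₂ refl = ¬Ps

firstRepetition : ∀ {n} (V : ℕ → Fin n) →
  Σ ℕ λ i → Σ ℕ λ J → i < J × V i ≡ V J × (∀ p q → p < J → q < J → V p ≡ V q → p ≡ q)
firstRepetition {n} V with leastWitness repeats? (proj₂ someRepeat)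
  where
  Repeats : ℕ → Set
  Repeats J = Σ (Fin J) λ i → V (toℕ i) ≡ V J
  repeats? : ∀ J → Dec (Repeats J)
  repeats? J = Fin.any? (λ i → V (toℕ i) ≟ᶠ V J)
  someRepeat : Σ ℕ Repeats
  someRepeat with i , j , i<j , Vi≡Vj ← Fin.pigeonhole (n<1+n n) (V ∘ toℕ {suc n})
    = toℕ j , fromℕ< i<j , trans (cong V (toℕ-fromℕ< i<j)) Vi≡Vj
... | J , (i , Vi≡VJ) , noEarlier = toℕ i , J , toℕ<n i , Vi≡VJ , V-inj
  where
  V-inj : ∀ p q → p < J → q < J → V p ≡ V q → p ≡ q
  V-inj p q p<J q<J Vp≡Vq with <-cmp p q
  ... | tri< p<q _ _ = contradiction (fromℕ< p<q , trans (cong V (toℕ-fromℕ< p<q)) Vp≡Vq) (noEarlier q q<J)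
  ... | tri≈ _ p≡q _ = p≡q
  ... | tri> _ _ q<p = contradiction (fromℕ< q<p , trans (cong V (toℕ-fromℕ< q<p)) (sym Vp≡Vq)) (noEarlier p p<J)

-- Degrees, matchings and edge colourings

module _ (G : Multigraph) where
  open Multigraph G

  incidence : (Fin m → Bool) → Fin n → Fin m → ℕ
  incidence P v x = 𝟙 (P x ∧ inc G x v)

  degree : (Fin m → Bool) → Fin n → ℕ
  degree P v = sum (incidence P v)

  sum-inc≡2 : ∀ x → ∑[ v < n ] 𝟙 (inc G x v) ≡ 2
  sum-inc≡2 x = begin
    ∑[ v < n ] 𝟙 (inc G x v)     ≡⟨ sum-cong-≗ inc≡δ+δ ⟩
    ∑[ v < n ] (δ s v + δ t v)   ≡⟨ ∑-distrib-+ (δ s) (δ t) ⟩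
    sum (δ s) + sum (δ t)        ≡⟨ cong₂ _+_ (sum-δ s) (sum-δ t) ⟩
    2                            ∎
    where
    open ≡-Reasoning
    s t : Fin n
    s = proj₁ (ends x)
    t = proj₂ (ends x)
    inc≡δ+δ : ∀ v → 𝟙 (inc G x v) ≡ δ s v + δ t v
    inc≡δ+δ v with s ≟ᶠ v | t ≟ᶠ v
    ... | yes s≡v | yes t≡v = ⊥-elim (loopless x (trans s≡v (sym t≡v)))
    ... | yes _   | no _    = refl
    ... | no _    | yes _   = refl
    ... | no _    | no _    = refl

  handshake : (P : Fin m → Bool) → ∑[ v < n ] degree P v ≡ 2 * ∑[ x < m ] 𝟙 (P x)
  handshake P = begin
    ∑[ v < n ] ∑[ x < m ] 𝟙 (P x ∧ inc G x v)       ≡⟨ ∑-comm (λ v x → 𝟙 (P x ∧ inc G x v)) ⟩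
    ∑[ x < m ] ∑[ v < n ] 𝟙 (P x ∧ inc G x v)       ≡⟨ sum-cong-≗ (λ x → sum-cong-≗ (λ v → 𝟙-∧ (P x) (inc G x v))) ⟩
    ∑[ x < m ] ∑[ v < n ] (𝟙 (P x) * 𝟙 (inc G x v)) ≡⟨ sum-cong-≗ (λ x → sym (*-distribˡ-sum (𝟙 (P x)) (λ v → 𝟙 (inc G x v)))) ⟩
    ∑[ x < m ] (𝟙 (P x) * ∑[ v < n ] 𝟙 (inc G x v)) ≡⟨ sum-cong-≗ (λ x → cong (𝟙 (P x) *_) (sum-inc≡2 x)) ⟩
    ∑[ x < m ] (𝟙 (P x) * 2)                        ≡⟨ sym (*-distribʳ-sum 2 (𝟙 ∘ P)) ⟩
    sum (𝟙 ∘ P) * 2                                 ≡⟨ *-comm (sum (𝟙 ∘ P)) 2 ⟩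
    2 * sum (𝟙 ∘ P)                                 ∎
    where open ≡-Reasoning

  ∣∩incSet∣≡degree : (X : EdgeSet G) (v : Fin n) → ∣ X ∩ incSet G v ∣ ≡ degree (lookup X) v
  ∣∩incSet∣≡degree X v = trans (∣p∣≡sum (X ∩ incSet G v)) (sum-cong-≗ (λ x → cong 𝟙 (begin
    lookup (X ∩ incSet G v) x             ≡⟨ lookup-∩ X (incSet G v) x ⟩
    lookup X x ∧ lookup (incSet G v) x    ≡⟨ cong (lookup X x ∧_) (lookup∘tabulate (λ e → inc G e v) x) ⟩
    lookup X x ∧ inc G x v                ∎)))
    where open ≡-Reasoning

  member⇒1≤degree : ∀ {P x v} → P x ≡ true → inc G x v ≡ true → 1 ≤ degree P v
  member⇒1≤degree {P} {x} {v} Px ix = ≤-trans (≤-reflexive (cong 𝟙 (sym (cong₂ _∧_ Px ix)))) (≤-sum (incidence P v) x)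

  Cubic⇒degree≡3 : Cubic G → ∀ v → degree (λ _ → true) v ≡ 3
  Cubic⇒degree≡3 cubic v = trans (sym (trans (∣p∣≡sum (incSet G v)) (sum-cong-≗ (λ x → cong 𝟙 (lookup∘tabulate (λ e → inc G e v) x))))) (cubic v)

  oneFactor⇒degree≡1 : (M : EdgeSet G) → IsOneFactor G M → ∀ v → degree (lookup M) v ≡ 1
  oneFactor⇒degree≡1 M M-factor v = trans (sym (∣∩incSet∣≡degree M v)) (M-factor v)

  IsMatching : (Fin m → Bool) → Set
  IsMatching P = ∀ {v e f} → e ≢ f → P e ≡ true → P f ≡ true → inc G e v ≡ true → inc G f v ≡ true → ⊥

  matching-mono : ∀ {P Q} → (∀ x → Q x ≡ true → P x ≡ true) → IsMatching P → IsMatching Q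
  matching-mono Q⊆P P-matching e≢f Qe Qf = P-matching e≢f (Q⊆P _ Qe) (Q⊆P _ Qf)

  singleton-matching : ∀ e₀ → IsMatching (λ x → ⌊ x ≟ᶠ e₀ ⌋)
  singleton-matching e₀ {e = e} {f} e≢f e≡e₀ f≡e₀ _ _ = e≢f (trans (isYes-true⁻¹ (e ≟ᶠ e₀) e≡e₀) (sym (isYes-true⁻¹ (f ≟ᶠ e₀) f≡e₀)))

  matching-∪ : ∀ {P Q} → IsMatching P → IsMatching Q →
    (∀ {v e f} → e ≢ f → P e ≡ true → Q f ≡ true → inc G e v ≡ true → inc G f v ≡ true → ⊥) →
    IsMatching (λ x → P x ∨ Q x)
  matching-∪ {P} {Q} P-matching Q-matching apart {v} {e} {f} e≢f PQe PQf ie if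
    with ∨-true (P e) PQe | ∨-true (P f) PQf
  ... | inj₁ Pe | inj₁ Pf = P-matching e≢f Pe Pf ie if
  ... | inj₁ Pe | inj₂ Qf = apart e≢f Pe Qf ie if
  ... | inj₂ Qe | inj₁ Pf = apart (e≢f ∘ sym) Pf Qe if ie
  ... | inj₂ Qe | inj₂ Qf = Q-matching e≢f Qe Qf ie if

  degree≤1⇒matching : ∀ {P} → (∀ v → degree P v ≤ 1) → IsMatching P
  degree≤1⇒matching {P} deg≤1 {v} {e} {f} e≢f Pe Pf ie if = 2≰1 (begin
    2                                          ≡⟨ cong₂ (λ a b → 𝟙 a + 𝟙 b) (cong₂ _∧_ Pe ie) (cong₂ _∧_ Pf if) ⟨
    𝟙 (P e ∧ inc G e v) + 𝟙 (P f ∧ inc G f v)  ≤⟨ sum-pair≤ (λ x → 𝟙 (P x ∧ inc G x v)) e f e≢f ⟩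
    degree P v                                 ≤⟨ deg≤1 v ⟩
    1                                          ∎)
    where
    open ≤-Reasoning
    2≰1 : ¬ (2 ≤ 1)
    2≰1 (s≤s ())

  oneFactor⇒matching : (M : EdgeSet G) → IsOneFactor G M → IsMatching (lookup M)
  oneFactor⇒matching M M-factor = degree≤1⇒matching (λ v → ≤-reflexive (oneFactor⇒degree≡1 M M-factor v))

  MinDegree2 : EdgeSet G → Set
  MinDegree2 X = ∀ {v x} → lookup X x ≡ true → inc G x v ≡ true → 2 ≤ degree (lookup X) v

  colourClasses⇒colorable : (c : Fin m → Fin 3) → (∀ i → IsMatching (λ x → ⌊ c x ≟ᶠ i ⌋)) → ThreeEdgeColorable G
  colourClasses⇒colorable c classes = c , λ e f v e≢f ie if ce≡cf →
    classes (c e) e≢f (isYes-true (c e ≟ᶠ c e) refl) (isYes-true (c f ≟ᶠ c e) (sym ce≡cf)) ie if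

  partition⇒colorable : (A B : Fin m → Bool) → IsMatching A → IsMatching (λ x → not (A x) ∧ B x) →
    IsMatching (λ x → not (A x) ∧ not (B x)) → ThreeEdgeColorable G
  partition⇒colorable A B M₀ M₁ M₂ = colourClasses⇒colorable (λ x → colour (A x) (B x)) classes
    where
    colour : Bool → Bool → Fin 3
    colour true  _     = zero
    colour false true  = suc zero
    colour false false = suc (suc zero)
    class : Fin 3 → Bool → Bool → Bool
    class zero             a b = a
    class (suc zero)       a b = not a ∧ b
    class (suc (suc zero)) a b = not a ∧ not b
    colour-class : ∀ i a b → ⌊ colour a b ≟ᶠ i ⌋ ≡ class i a b
    colour-class zero             true  b     = refl
    colour-class zero             false true  = refl
    colour-class zero             false false = refl
    colour-class (suc zero)       true  b     = refl
    colour-class (suc zero)       false true  = refl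
    colour-class (suc zero)       false false = refl
    colour-class (suc (suc zero)) true  b     = refl
    colour-class (suc (suc zero)) false true  = refl
    colour-class (suc (suc zero)) false false = refl
    classes : ∀ i → IsMatching (λ x → ⌊ colour (A x) (B x) ≟ᶠ i ⌋)
    classes i = matching-mono (λ x eq → trans (sym (colour-class i (A x) (B x))) eq) (matching i)
      where
      matching : ∀ i → IsMatching (λ x → class i (A x) (B x))
      matching zero             = M₀
      matching (suc zero)       = M₁
      matching (suc (suc zero)) = M₂

  disjointOneFactors⇒colorable : Cubic G → (A B : EdgeSet G) → IsOneFactor G A → IsOneFactor G B →
    ∣ A ∩ B ∣ ≡ 0 → ThreeEdgeColorable G
  disjointOneFactors⇒colorable cubic A B A-factor B-factor ∣A∩B∣≡0 =
    partition⇒colorable (lookup A) (lookup B) (oneFactor⇒matching A A-factor)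
      (matching-mono (λ x → ∧-conicalʳ (not (lookup A x)) (lookup B x)) (oneFactor⇒matching B B-factor))
      (degree≤1⇒matching (λ v → ≤-reflexive (rest≡1 v)))
    where
    R : Fin m → Bool
    R x = not (lookup A x) ∧ not (lookup B x)
    split : ∀ a b s → a ∧ b ≡ false → 𝟙 s ≡ 𝟙 (a ∧ s) + 𝟙 (b ∧ s) + 𝟙 ((not a ∧ not b) ∧ s)
    split true  false true  _ = refl
    split true  false false _ = refl
    split false true  true  _ = refl
    split false true  false _ = refl
    split false false s     _ = refl
    disjoint : ∀ x → lookup A x ∧ lookup B x ≡ false
    disjoint x with lookup A x ∧ lookup B x in A∧B
    ... | false = refl
    ... | true  = contradiction (begin
      1                           ≡⟨ cong 𝟙 (trans (sym A∧B) (sym (lookup-∩ A B x))) ⟩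
      𝟙 (lookup (A ∩ B) x)        ≤⟨ ≤-sum _ x ⟩
      sum (𝟙 ∘ lookup (A ∩ B))    ≡⟨ ∣p∣≡sum (A ∩ B) ⟨
      ∣ A ∩ B ∣                   ≡⟨ ∣A∩B∣≡0 ⟩
      0                           ∎) λ ()
      where open ≤-Reasoning
    rest≡1 : ∀ v → degree R v ≡ 1
    rest≡1 v = +-cancelˡ-≡ 2 _ _ (begin
      2 + degree R v
        ≡⟨ cong (_+ degree R v) (cong₂ _+_ (oneFactor⇒degree≡1 A A-factor v) (oneFactor⇒degree≡1 B B-factor v)) ⟨
      degree (lookup A) v + degree (lookup B) v + degree R v   ≡⟨ ∑-distrib-+₃ (incidence (lookup A) v) (incidence (lookup B) v) (incidence R v) ⟨
      ∑[ x < m ] (𝟙 (lookup A x ∧ inc G x v) + 𝟙 (lookup B x ∧ inc G x v) + 𝟙 (R x ∧ inc G x v))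
                                                          ≡⟨ sum-cong-≗ (λ x → split (lookup A x) (lookup B x) (inc G x v) (disjoint x)) ⟨
      degree (λ _ → true) v                               ≡⟨ Cubic⇒degree≡3 cubic v ⟩
      3                                                   ∎)
      where open ≡-Reasoning


-- Edges classified by the factors containing them

sum≤2⇒some≡0 : ∀ {a b c} → a + b + c ≤ 2 → a ≡ 0 ⊎ b ≡ 0 ⊎ c ≡ 0
sum≤2⇒some≡0 {zero}                 _ = inj₁ refl
sum≤2⇒some≡0 {suc _} {zero}         _ = inj₂ (inj₁ refl)
sum≤2⇒some≡0 {suc _} {suc _} {zero} _ = inj₂ (inj₂ refl)
sum≤2⇒some≡0 {suc a} {suc b} {suc c} a+b+c≤2
  with ≤-trans (+-mono-≤ (+-mono-≤ (s≤s (z≤n {a})) (s≤s (z≤n {b}))) (s≤s (z≤n {c}))) a+b+c≤2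
... | s≤s (s≤s ())

fewUncovered : ∀ {U D T} → U ≡ D + 2 * T → U < 3 → (T ≡ 0 × D ≤ 2) ⊎ (D ≡ 0 × 1 ≤ U)
fewUncovered {T = zero}                 refl U<3 = inj₁ (refl , subst (_≤ 2) (+-identityʳ _) (≤-pred U<3))
fewUncovered {D = zero}  {T = suc _}    refl _   = inj₂ (refl , s≤s z≤n)
fewUncovered {D = suc d} {T = suc t}    refl U<3 = contradiction U<3 (≤⇒≯ (+-mono-≤ (s≤s (z≤n {d})) (*-monoʳ-≤ 2 (s≤s (z≤n {t})))))

-- The arguments say whether an edge lies in M₁, M₂, M₃.
exactly0 exactly1 exactly2 exactly3 : Bool → Bool → Bool → Bool
exactly0 b₁ b₂ b₃ = not ((b₁ ∨ b₂) ∨ b₃)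
exactly3 b₁ b₂ b₃ = (b₁ ∧ b₂) ∧ b₃
exactly1 true  false false = true
exactly1 false true  false = true
exactly1 false false true  = true
exactly1 _     _     _     = false
exactly2 true  true  false = true
exactly2 true  false true  = true
exactly2 false true  true  = true
exactly2 _     _     _     = false

inCore : Bool → Bool → Bool → Bool
inCore b₁ b₂ b₃ = (((b₁ ∧ b₂) ∨ (b₁ ∧ b₃)) ∨ (b₂ ∧ b₃)) ∨ exactly0 b₁ b₂ b₃

classes-partition : ∀ b₁ b₂ b₃ s →
  𝟙 s ≡ 𝟙 (exactly3 b₁ b₂ b₃ ∧ s) + 𝟙 (exactly2 b₁ b₂ b₃ ∧ s) + 𝟙 (exactly1 b₁ b₂ b₃ ∧ s) + 𝟙 (exactly0 b₁ b₂ b₃ ∧ s)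
classes-partition false false false false = refl
classes-partition false false false true  = refl
classes-partition false false true  false = refl
classes-partition false false true  true  = refl
classes-partition false true  false false = refl
classes-partition false true  false true  = refl
classes-partition false true  true  false = refl
classes-partition false true  true  true  = refl
classes-partition true  false false false = refl
classes-partition true  false false true  = refl
classes-partition true  false true  false = refl
classes-partition true  false true  true  = refl
classes-partition true  true  false false = refl
classes-partition true  true  false true  = refl
classes-partition true  true  true  false = refl
classes-partition true  true  true  true  = refl

factors-by-class : ∀ b₁ b₂ b₃ s → 𝟙 (b₁ ∧ s) + 𝟙 (b₂ ∧ s) + 𝟙 (b₃ ∧ s)
  ≡ 3 * 𝟙 (exactly3 b₁ b₂ b₃ ∧ s) + 2 * 𝟙 (exactly2 b₁ b₂ b₃ ∧ s) + 𝟙 (exactly1 b₁ b₂ b₃ ∧ s)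
factors-by-class false false false false = refl
factors-by-class false false false true  = refl
factors-by-class false false true  false = refl
factors-by-class false false true  true  = refl
factors-by-class false true  false false = refl
factors-by-class false true  false true  = refl
factors-by-class false true  true  false = refl
factors-by-class false true  true  true  = refl
factors-by-class true  false false false = refl
factors-by-class true  false false true  = refl
factors-by-class true  false true  false = refl
factors-by-class true  false true  true  = refl
factors-by-class true  true  false false = refl
factors-by-class true  true  false true  = refl
factors-by-class true  true  true  false = refl
factors-by-class true  true  true  true  = refl

inCore-by-class : ∀ b₁ b₂ b₃ s →
  𝟙 (inCore b₁ b₂ b₃ ∧ s) ≡ 𝟙 (exactly0 b₁ b₂ b₃ ∧ s) + 𝟙 (exactly2 b₁ b₂ b₃ ∧ s) + 𝟙 (exactly3 b₁ b₂ b₃ ∧ s)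
inCore-by-class false false false false = refl
inCore-by-class false false false true  = refl
inCore-by-class false false true  false = refl
inCore-by-class false false true  true  = refl
inCore-by-class false true  false false = refl
inCore-by-class false true  false true  = refl
inCore-by-class false true  true  false = refl
inCore-by-class false true  true  true  = refl
inCore-by-class true  false false false = refl
inCore-by-class true  false false true  = refl
inCore-by-class true  false true  false = refl
inCore-by-class true  false true  true  = refl
inCore-by-class true  true  false false = refl
inCore-by-class true  true  false true  = refl
inCore-by-class true  true  true  false = refl
inCore-by-class true  true  true  true  = refl

inCore-count : ∀ b₁ b₂ b₃ → 𝟙 (inCore b₁ b₂ b₃) ≡ 𝟙 (exactly0 b₁ b₂ b₃) + 𝟙 (exactly2 b₁ b₂ b₃) + 𝟙 (exactly3 b₁ b₂ b₃)
inCore-count false false false = refl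
inCore-count false false true  = refl
inCore-count false true  false = refl
inCore-count false true  true  = refl
inCore-count true  false false = refl
inCore-count true  false true  = refl
inCore-count true  true  false = refl
inCore-count true  true  true  = refl

pairs-count : ∀ b₁ b₂ b₃ → 𝟙 (b₁ ∧ b₂) + 𝟙 (b₁ ∧ b₃) + 𝟙 (b₂ ∧ b₃) ≡ 𝟙 (exactly2 b₁ b₂ b₃) + 3 * 𝟙 (exactly3 b₁ b₂ b₃)
pairs-count false false false = refl
pairs-count false false true  = refl
pairs-count false true  false = refl
pairs-count false true  true  = refl
pairs-count true  false false = refl
pairs-count true  false true  = refl
pairs-count true  true  false = refl
pairs-count true  true  true  = refl

second-not-first : ∀ a b c → not a ∧ b ≡ true → exactly1 a b c ≡ true ⊎ exactly2 a b c ≡ true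
second-not-first false true false _ = inj₁ refl
second-not-first false true true  _ = inj₂ refl

third-only : ∀ a b c → (not a ∧ not b) ∧ c ≡ true → exactly1 a b c ≡ true
third-only false false true _ = refl

-- The possible numbers (T, D, O, U) of edges at a vertex lying in exactly 3, 2, 1, 0 of the factors.
data IncidencePattern : ℕ → ℕ → ℕ → ℕ → Set where
  outsideCore : IncidencePattern 0 0 3 0
  coreDegree2 : IncidencePattern 0 1 1 1
  coreDegree3 : IncidencePattern 1 0 0 2

incidencePattern : ∀ {T D O U} → T + D + O + U ≡ 3 → 3 * T + 2 * D + O ≡ 3 → IncidencePattern T D O U
incidencePattern {T} {D} {O} {U} all≡3 factors≡3 = classify T D (2x≤3⇒x≤1 (≤-trans 2[D+T]≤ (≤-reflexive factors≡3))) all≡3 factors≡3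
  where
  2[D+T]≤ : 2 * (D + T) ≤ 3 * T + 2 * D + O
  2[D+T]≤ = subst (2 * (D + T) ≤_) (rearrange D T O) (m≤m+n (2 * (D + T)) (T + O))
    where
    rearrange : ∀ D T O → 2 * (D + T) + (T + O) ≡ 3 * T + 2 * D + O
    rearrange = solve-∀
  2x≤3⇒x≤1 : ∀ {x} → 2 * x ≤ 3 → x ≤ 1
  2x≤3⇒x≤1 {zero}        _ = z≤n
  2x≤3⇒x≤1 {suc zero}    _ = ≤-refl
  2x≤3⇒x≤1 {suc (suc x)} 2x≤3 with ≤-trans (*-monoʳ-≤ 2 (s≤s (s≤s (z≤n {x})))) 2x≤3
  ... | s≤s (s≤s (s≤s ()))
  classify : ∀ T D {O U} → D + T ≤ 1 → T + D + O + U ≡ 3 → 3 * T + 2 * D + O ≡ 3 → IncidencePattern T D O U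
  classify zero          zero          _ refl refl = outsideCore
  classify zero          (suc zero)    _ refl refl = coreDegree2
  classify (suc zero)    zero          _ refl refl = coreDegree3
  classify (suc _)       (suc zero)    (s≤s ())
  classify _             (suc (suc _)) (s≤s ())
  classify (suc (suc _)) zero          (s≤s ())

module _ {T D O U : ℕ} where
  pattern-balance : IncidencePattern T D O U → U ≡ D + 2 * T
  pattern-balance outsideCore = refl
  pattern-balance coreDegree2 = refl
  pattern-balance coreDegree3 = refl

  pattern-vertex : IncidencePattern T D O U → 𝟙 ⌊ 1 ≤? U + D + T ⌋ + T ≡ U
  pattern-vertex outsideCore = refl
  pattern-vertex coreDegree2 = refl
  pattern-vertex coreDegree3 = refl

  pattern-tip : IncidencePattern T D O U → D ≡ 0 → 1 ≤ U → O ≡ 0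
  pattern-tip coreDegree3 _ _ = refl

  pattern-minDegree : IncidencePattern T D O U → 1 ≤ U + D + T → 2 ≤ U + D + T
  pattern-minDegree coreDegree2 _ = s≤s (s≤s z≤n)
  pattern-minDegree coreDegree3 _ = s≤s (s≤s z≤n)

module Core (G : Multigraph) (cubic : Cubic G) (M₁ M₂ M₃ : EdgeSet G)
  (M₁-factor : IsOneFactor G M₁) (M₂-factor : IsOneFactor G M₂) (M₃-factor : IsOneFactor G M₃) where
  open Multigraph G

  class : (Bool → Bool → Bool → Bool) → Fin m → Bool
  class P x = P (lookup M₁ x) (lookup M₂ x) (lookup M₃ x)

  deg : (Bool → Bool → Bool → Bool) → Fin n → ℕ
  deg P = degree G (class P)

  count : (Bool → Bool → Bool → Bool) → ℕ
  count P = ∑[ x < m ] 𝟙 (class P x)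

  at : Fin n → (Bool → Bool → Bool → Bool) → Fin m → ℕ
  at v P = incidence G (class P) v

  pattern-at : ∀ v → IncidencePattern (deg exactly3 v) (deg exactly2 v) (deg exactly1 v) (deg exactly0 v)
  pattern-at v = incidencePattern all≡3 factors≡3
    where
    open ≡-Reasoning
    all≡3 : deg exactly3 v + deg exactly2 v + deg exactly1 v + deg exactly0 v ≡ 3
    all≡3 = begin
      deg exactly3 v + deg exactly2 v + deg exactly1 v + deg exactly0 v
        ≡⟨ cong (_+ deg exactly0 v) (∑-distrib-+₃ (at v exactly3) (at v exactly2) (at v exactly1)) ⟨
      sum (λ x → at v exactly3 x + at v exactly2 x + at v exactly1 x) + deg exactly0 v
        ≡⟨ ∑-distrib-+ _ (at v exactly0) ⟨
      ∑[ x < m ] (at v exactly3 x + at v exactly2 x + at v exactly1 x + at v exactly0 x)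
        ≡⟨ sum-cong-≗ (λ x → classes-partition (lookup M₁ x) (lookup M₂ x) (lookup M₃ x) (inc G x v)) ⟨
      degree G (λ _ → true) v
        ≡⟨ Cubic⇒degree≡3 G cubic v ⟩
      3 ∎
    factors≡3 : 3 * deg exactly3 v + 2 * deg exactly2 v + deg exactly1 v ≡ 3
    factors≡3 = begin
      3 * deg exactly3 v + 2 * deg exactly2 v + deg exactly1 v
        ≡⟨ cong₂ (λ a b → a + b + deg exactly1 v) (*-distribˡ-sum 3 (at v exactly3)) (*-distribˡ-sum 2 (at v exactly2)) ⟩
      ∑[ x < m ] (3 * at v exactly3 x) + ∑[ x < m ] (2 * at v exactly2 x) + deg exactly1 v
        ≡⟨ ∑-distrib-+₃ (λ x → 3 * at v exactly3 x) (λ x → 2 * at v exactly2 x) (at v exactly1) ⟨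
      ∑[ x < m ] (3 * at v exactly3 x + 2 * at v exactly2 x + at v exactly1 x)
        ≡⟨ sum-cong-≗ (λ x → factors-by-class (lookup M₁ x) (lookup M₂ x) (lookup M₃ x) (inc G x v)) ⟨
      ∑[ x < m ] (incidence G (lookup M₁) v x + incidence G (lookup M₂) v x + incidence G (lookup M₃) v x)
        ≡⟨ ∑-distrib-+₃ (incidence G (lookup M₁) v) (incidence G (lookup M₂) v) (incidence G (lookup M₃) v) ⟩
      degree G (lookup M₁) v + degree G (lookup M₂) v + degree G (lookup M₃) v
        ≡⟨ cong₂ _+_ (cong₂ _+_ (oneFactor⇒degree≡1 G M₁ M₁-factor v) (oneFactor⇒degree≡1 G M₂ M₂-factor v))
                     (oneFactor⇒degree≡1 G M₃ M₃-factor v) ⟩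
      3 ∎

  lookup-uncovered : ∀ x → lookup (uncovered G M₁ M₂ M₃) x ≡ class exactly0 x
  lookup-uncovered x rewrite lookup-∁ ((M₁ ∪ M₂) ∪ M₃) x | lookup-∪ (M₁ ∪ M₂) M₃ x | lookup-∪ M₁ M₂ x = refl

  lookup-triple : ∀ x → lookup ((M₁ ∩ M₂) ∩ M₃) x ≡ class exactly3 x
  lookup-triple x rewrite lookup-∩ (M₁ ∩ M₂) M₃ x | lookup-∩ M₁ M₂ x = refl

  lookup-core : ∀ x → lookup (coreEdges G M₁ M₂ M₃) x ≡ class inCore x
  lookup-core x
    rewrite lookup-∪ (multiplyCovered G M₁ M₂ M₃) (uncovered G M₁ M₂ M₃) x | lookup-uncovered x
          | lookup-∪ ((M₁ ∩ M₂) ∪ (M₁ ∩ M₃)) (M₂ ∩ M₃) x | lookup-∪ (M₁ ∩ M₂) (M₁ ∩ M₃) x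
          | lookup-∩ M₁ M₂ x | lookup-∩ M₁ M₃ x | lookup-∩ M₂ M₃ x = refl

  ∣∣≡count : (X : EdgeSet G) (P : Bool → Bool → Bool → Bool) → (∀ x → lookup X x ≡ class P x) → ∣ X ∣ ≡ count P
  ∣∣≡count X P X≡P = trans (∣p∣≡sum X) (sum-cong-≗ (cong 𝟙 ∘ X≡P))

  ∣uncovered∣≡count : ∣ uncovered G M₁ M₂ M₃ ∣ ≡ count exactly0
  ∣uncovered∣≡count = ∣∣≡count (uncovered G M₁ M₂ M₃) exactly0 lookup-uncovered

  ∣triple∣≡count : ∣ (M₁ ∩ M₂) ∩ M₃ ∣ ≡ count exactly3
  ∣triple∣≡count = ∣∣≡count ((M₁ ∩ M₂) ∩ M₃) exactly3 lookup-triple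

  core-degree : ∀ v → degree G (lookup (coreEdges G M₁ M₂ M₃)) v ≡ deg exactly0 v + deg exactly2 v + deg exactly3 v
  core-degree v = begin
    degree G (lookup (coreEdges G M₁ M₂ M₃)) v   ≡⟨ sum-cong-≗ (λ x → cong (λ b → 𝟙 (b ∧ inc G x v)) (lookup-core x)) ⟩
    deg inCore v                                ≡⟨ sum-cong-≗ (λ x → inCore-by-class (lookup M₁ x) (lookup M₂ x) (lookup M₃ x) (inc G x v)) ⟩
    ∑[ x < m ] (at v exactly0 x + at v exactly2 x + at v exactly3 x)
                                                ≡⟨ ∑-distrib-+₃ (at v exactly0) (at v exactly2) (at v exactly3) ⟩
    deg exactly0 v + deg exactly2 v + deg exactly3 v ∎
    where open ≡-Reasoning

  count-balance : count exactly0 ≡ count exactly2 + 2 * count exactly3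
  count-balance = *-cancelˡ-≡ _ _ 2 (begin
    2 * count exactly0                                 ≡⟨ handshake G (class exactly0) ⟨
    ∑[ v < n ] deg exactly0 v                          ≡⟨ sum-cong-≗ (pattern-balance ∘ pattern-at) ⟩
    ∑[ v < n ] (deg exactly2 v + 2 * deg exactly3 v)   ≡⟨ ∑-distrib-+ (deg exactly2) (λ v → 2 * deg exactly3 v) ⟩
    sum (deg exactly2) + ∑[ v < n ] (2 * deg exactly3 v) ≡⟨ cong (sum (deg exactly2) +_) (*-distribˡ-sum 2 (deg exactly3)) ⟨
    sum (deg exactly2) + 2 * sum (deg exactly3)        ≡⟨ cong₂ (λ a b → a + 2 * b) (handshake G (class exactly2)) (handshake G (class exactly3)) ⟩
    2 * count exactly2 + 2 * (2 * count exactly3)      ≡⟨ *-distribˡ-+ 2 (count exactly2) (2 * count exactly3) ⟨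
    2 * (count exactly2 + 2 * count exactly3)          ∎)
    where open ≡-Reasoning

  core-vertices : ∣ verticesOf G (coreEdges G M₁ M₂ M₃) ∣ + 2 * ∣ (M₁ ∩ M₂) ∩ M₃ ∣ ≡ 2 * ∣ uncovered G M₁ M₂ M₃ ∣
  core-vertices = begin
    ∣ verticesOf G C ∣ + 2 * ∣ (M₁ ∩ M₂) ∩ M₃ ∣
      ≡⟨ cong₂ _+_ (trans (∣p∣≡sum (verticesOf G C)) (sum-cong-≗ isVertex))
                   (trans (cong (2 *_) ∣triple∣≡count) (sym (handshake G (class exactly3)))) ⟩
    ∑[ v < n ] 𝟙 ⌊ 1 ≤? coreDeg v ⌋ + sum (deg exactly3)
      ≡⟨ ∑-distrib-+ (λ v → 𝟙 ⌊ 1 ≤? coreDeg v ⌋) (deg exactly3) ⟨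
    ∑[ v < n ] (𝟙 ⌊ 1 ≤? coreDeg v ⌋ + deg exactly3 v)
      ≡⟨ sum-cong-≗ (pattern-vertex ∘ pattern-at) ⟩
    sum (deg exactly0)
      ≡⟨ handshake G (class exactly0) ⟩
    2 * count exactly0
      ≡⟨ cong (2 *_) ∣uncovered∣≡count ⟨
    2 * ∣ uncovered G M₁ M₂ M₃ ∣ ∎
    where
    open ≡-Reasoning
    C : EdgeSet G
    C = coreEdges G M₁ M₂ M₃
    coreDeg : Fin n → ℕ
    coreDeg v = deg exactly0 v + deg exactly2 v + deg exactly3 v
    isVertex : ∀ v → 𝟙 (lookup (verticesOf G C) v) ≡ 𝟙 ⌊ 1 ≤? coreDeg v ⌋
    isVertex v = cong 𝟙 (trans (lookup∘tabulate _ v) (cong (λ d → ⌊ 1 ≤? d ⌋) (trans (∣∩incSet∣≡degree G C v) (core-degree v))))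

  core-edges : ∣ coreEdges G M₁ M₂ M₃ ∣ + ∣ (M₁ ∩ M₂) ∩ M₃ ∣ ≡ 2 * ∣ uncovered G M₁ M₂ M₃ ∣
  core-edges = begin
    ∣ coreEdges G M₁ M₂ M₃ ∣ + ∣ (M₁ ∩ M₂) ∩ M₃ ∣
      ≡⟨ cong₂ _+_ (∣∣≡count (coreEdges G M₁ M₂ M₃) inCore lookup-core) ∣triple∣≡count ⟩
    count inCore + count exactly3
      ≡⟨ cong (_+ count exactly3) (trans (sum-cong-≗ (λ x → inCore-count (lookup M₁ x) (lookup M₂ x) (lookup M₃ x)))
                                          (∑-distrib-+₃ (𝟙 ∘ class exactly0) (𝟙 ∘ class exactly2) (𝟙 ∘ class exactly3))) ⟩
    count exactly0 + count exactly2 + count exactly3 + count exactly3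
      ≡⟨ regroup (count exactly0) (count exactly2) (count exactly3) ⟩
    count exactly0 + (count exactly2 + 2 * count exactly3)
      ≡⟨ cong (count exactly0 +_) count-balance ⟨
    count exactly0 + count exactly0
      ≡⟨ cong (count exactly0 +_) (+-identityʳ (count exactly0)) ⟨
    2 * count exactly0
      ≡⟨ cong (2 *_) ∣uncovered∣≡count ⟨
    2 * ∣ uncovered G M₁ M₂ M₃ ∣ ∎
    where
    open ≡-Reasoning
    regroup : ∀ u d t → u + d + t + t ≡ u + (d + 2 * t)
    regroup = solve-∀

  ∣∩∣≡sum : (A B : EdgeSet G) → ∣ A ∩ B ∣ ≡ ∑[ x < m ] 𝟙 (lookup A x ∧ lookup B x)
  ∣∩∣≡sum A B = trans (∣p∣≡sum (A ∩ B)) (sum-cong-≗ (cong 𝟙 ∘ lookup-∩ A B))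

  pairwise-intersections : ∣ M₁ ∩ M₂ ∣ + ∣ M₁ ∩ M₃ ∣ + ∣ M₂ ∩ M₃ ∣ ≡ count exactly2 + 3 * count exactly3
  pairwise-intersections = begin
    ∣ M₁ ∩ M₂ ∣ + ∣ M₁ ∩ M₃ ∣ + ∣ M₂ ∩ M₃ ∣
      ≡⟨ cong₂ _+_ (cong₂ _+_ (∣∩∣≡sum M₁ M₂) (∣∩∣≡sum M₁ M₃)) (∣∩∣≡sum M₂ M₃) ⟩
    sum (both M₁ M₂) + sum (both M₁ M₃) + sum (both M₂ M₃)
      ≡⟨ ∑-distrib-+₃ (both M₁ M₂) (both M₁ M₃) (both M₂ M₃) ⟨
    ∑[ x < m ] (both M₁ M₂ x + both M₁ M₃ x + both M₂ M₃ x)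
      ≡⟨ sum-cong-≗ (λ x → pairs-count (lookup M₁ x) (lookup M₂ x) (lookup M₃ x)) ⟩
    ∑[ x < m ] (𝟙 (class exactly2 x) + 3 * 𝟙 (class exactly3 x))
      ≡⟨ ∑-distrib-+ (𝟙 ∘ class exactly2) (λ x → 3 * 𝟙 (class exactly3 x)) ⟩
    count exactly2 + ∑[ x < m ] (3 * 𝟙 (class exactly3 x))
      ≡⟨ cong (count exactly2 +_) (*-distribˡ-sum 3 (𝟙 ∘ class exactly3)) ⟨
    count exactly2 + 3 * count exactly3 ∎
    where
    open ≡-Reasoning
    both : EdgeSet G → EdgeSet G → Fin m → ℕ
    both A B x = 𝟙 (lookup A x ∧ lookup B x)

  colorable-without-triples : count exactly3 ≡ 0 → count exactly2 ≤ 2 → ThreeEdgeColorable G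
  colorable-without-triples t≡0 d≤2 with sum≤2⇒some≡0 pairwise≤2
    where
    pairwise≤2 : ∣ M₁ ∩ M₂ ∣ + ∣ M₁ ∩ M₃ ∣ + ∣ M₂ ∩ M₃ ∣ ≤ 2
    pairwise≤2 = ≤-trans (≤-reflexive (trans pairwise-intersections (cong (λ t → count exactly2 + 3 * t) t≡0)))
                         (subst (_≤ 2) (sym (+-identityʳ _)) d≤2)
  ... | inj₁ ∣M₁∩M₂∣≡0        = disjointOneFactors⇒colorable G cubic M₁ M₂ M₁-factor M₂-factor ∣M₁∩M₂∣≡0
  ... | inj₂ (inj₁ ∣M₁∩M₃∣≡0) = disjointOneFactors⇒colorable G cubic M₁ M₃ M₁-factor M₃-factor ∣M₁∩M₃∣≡0
  ... | inj₂ (inj₂ ∣M₂∩M₃∣≡0) = disjointOneFactors⇒colorable G cubic M₂ M₃ M₂-factor M₃-factor ∣M₂∩M₃∣≡0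

  module _ (d≡0 : count exactly2 ≡ 0) where
    no-double-edge : ∀ x → class exactly2 x ≢ true
    no-double-edge x Dx with ≤-trans (subst (_≤ count exactly2) (cong 𝟙 Dx) (≤-sum _ x)) (≤-reflexive d≡0)
    ... | ()

    no-double-edge-at : ∀ v → deg exactly2 v ≡ 0
    no-double-edge-at v = n≤0⇒n≡0 (≤-trans (≤-sum (deg exactly2) v) (≤-reflexive (trans (handshake G (class exactly2)) (cong (2 *_) d≡0))))

    single-avoids-uncovered : ∀ {v x y} → class exactly1 y ≡ true → class exactly0 x ≡ true →
      inc G y v ≡ true → inc G x v ≡ true → ⊥
    single-avoids-uncovered {v} Oy Ux iy ix = contradiction (member⇒1≤degree G Oy iy)
      (subst (λ o → ¬ (1 ≤ o)) (sym (pattern-tip (pattern-at v) (no-double-edge-at v) (member⇒1≤degree G Ux ix))) λ ())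

    -- Colour M₁ (which contains the triple edges), then M₂ − M₁ together with one uncovered edge e₀,
    -- then the rest: the edges of M₃ only and the other uncovered edges.
    colorable-with-triples : count exactly0 ≤ 2 → 1 ≤ count exactly0 → ThreeEdgeColorable G
    colorable-with-triples u≤2 1≤u =
      partition⇒colorable G (lookup M₁) (λ x → lookup M₂ x ∨ is-e₀ x) (oneFactor⇒matching G M₁ M₁-factor)
        (matching-mono G (λ x → colour1⊆ (lookup M₁ x) (lookup M₂ x) (is-e₀ x))
          (matching-∪ G M₂-only-matching (singleton-matching G e₀) M₂-only-avoids-e₀))
        (matching-mono G (λ x → colour2⊆ (lookup M₁ x) (lookup M₂ x) (lookup M₃ x) (is-e₀ x))
          (matching-∪ G M₃-only-matching others-matching M₃-only-avoids-others))
      where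
      e₀ : Fin m
      e₀ = proj₁ (1≤sum-𝟙⇒∃ (class exactly0) 1≤u)
      e₀-uncovered : class exactly0 e₀ ≡ true
      e₀-uncovered = proj₂ (1≤sum-𝟙⇒∃ (class exactly0) 1≤u)
      is-e₀ : Fin m → Bool
      is-e₀ x = ⌊ x ≟ᶠ e₀ ⌋

      colour1⊆ : ∀ a b z → not a ∧ (b ∨ z) ≡ true → (not a ∧ b) ∨ z ≡ true
      colour1⊆ false true  z    _ = refl
      colour1⊆ false false true _ = refl
      colour2⊆ : ∀ a b c z → not a ∧ not (b ∨ z) ≡ true → ((not a ∧ not b) ∧ c) ∨ (exactly0 a b c ∧ not z) ≡ true
      colour2⊆ false false true  false _ = refl
      colour2⊆ false false false false _ = refl

      M₂-only-matching : IsMatching G (λ x → not (lookup M₁ x) ∧ lookup M₂ x)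
      M₂-only-matching = matching-mono G (λ x → ∧-conicalʳ (not (lookup M₁ x)) (lookup M₂ x)) (oneFactor⇒matching G M₂ M₂-factor)
      M₃-only-matching : IsMatching G (λ x → (not (lookup M₁ x) ∧ not (lookup M₂ x)) ∧ lookup M₃ x)
      M₃-only-matching = matching-mono G (λ x → ∧-conicalʳ (not (lookup M₁ x) ∧ not (lookup M₂ x)) (lookup M₃ x))
                                          (oneFactor⇒matching G M₃ M₃-factor)
      others-matching : IsMatching G (λ x → class exactly0 x ∧ not (is-e₀ x))
      others-matching {e = e} {f} e≢f Ue∧e≢e₀ Uf∧f≢e₀ _ _ with ∧-true Ue∧e≢e₀ | ∧-true Uf∧f≢e₀
      ... | Ue , e≢e₀ | Uf , f≢e₀ = contradiction (begin
        3
          ≡⟨ cong₂ _+_ (cong₂ (λ a b → 𝟙 a + 𝟙 b) Ue Uf) (cong 𝟙 e₀-uncovered) ⟨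
        𝟙 (class exactly0 e) + 𝟙 (class exactly0 f) + 𝟙 (class exactly0 e₀)
          ≤⟨ sum-triple≤ (𝟙 ∘ class exactly0) e f e₀ e≢f (isNo-true⁻¹ (e ≟ᶠ e₀) e≢e₀) (isNo-true⁻¹ (f ≟ᶠ e₀) f≢e₀) ⟩
        count exactly0
          ≤⟨ u≤2 ⟩
        2 ∎) λ { (s≤s (s≤s ())) }
        where open ≤-Reasoning
      M₂-only-avoids-e₀ : ∀ {v e f} → e ≢ f → not (lookup M₁ e) ∧ lookup M₂ e ≡ true → is-e₀ f ≡ true →
        inc G e v ≡ true → inc G f v ≡ true → ⊥
      M₂-only-avoids-e₀ {e = e} {f} _ M₂e f≡e₀ ie if with second-not-first (lookup M₁ e) (lookup M₂ e) (lookup M₃ e) M₂e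
      ... | inj₁ Oe = single-avoids-uncovered Oe (subst (λ x → class exactly0 x ≡ true) (sym (isYes-true⁻¹ (f ≟ᶠ e₀) f≡e₀)) e₀-uncovered) ie if
      ... | inj₂ De = no-double-edge e De
      M₃-only-avoids-others : ∀ {v e f} → e ≢ f → (not (lookup M₁ e) ∧ not (lookup M₂ e)) ∧ lookup M₃ e ≡ true →
        class exactly0 f ∧ not (is-e₀ f) ≡ true → inc G e v ≡ true → inc G f v ≡ true → ⊥
      M₃-only-avoids-others {e = e} _ M₃e Uf ie if =
        single-avoids-uncovered (third-only (lookup M₁ e) (lookup M₂ e) (lookup M₃ e) M₃e) (∧-conicalˡ _ _ Uf) ie if

  colorable : count exactly0 < 3 → ThreeEdgeColorable G
  colorable u<3 with fewUncovered count-balance u<3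
  ... | inj₁ (t≡0 , d≤2) = colorable-without-triples t≡0 d≤2
  ... | inj₂ (d≡0 , 1≤u) = colorable-with-triples d≡0 (≤-pred u<3) 1≤u

  core-minDegree2 : MinDegree2 G (coreEdges G M₁ M₂ M₃)
  core-minDegree2 {v} x∈C ix = subst (2 ≤_) (sym (core-degree v))
    (pattern-minDegree (pattern-at v) (subst (1 ≤_) (core-degree v) (member⇒1≤degree G x∈C ix)))

  uncovered⊆core : ∀ {x} → lookup (uncovered G M₁ M₂ M₃) x ≡ true → lookup (coreEdges G M₁ M₂ M₃) x ≡ true
  uncovered⊆core {x} x∈U = trans (lookup-∪ (multiplyCovered G M₁ M₂ M₃) (uncovered G M₁ M₂ M₃) x)
    (trans (cong (lookup (multiplyCovered G M₁ M₂ M₃) x ∨_) x∈U) (∨-zeroʳ _))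


-- Circuits from non-backtracking walks

module _ (G : Multigraph) where
  open Multigraph G

  joins⇒inc : ∀ {e x y} → Joins G e x y → inc G e x ≡ true
  joins⇒inc {e} {x} (inj₁ (s≡x , _)) = cong (_∨ ⌊ proj₂ (ends e) ≟ᶠ x ⌋) (isYes-true (proj₁ (ends e) ≟ᶠ x) s≡x)
  joins⇒inc {e} {x} (inj₂ (_ , t≡x)) = trans (cong (⌊ proj₁ (ends e) ≟ᶠ x ⌋ ∨_) (isYes-true (proj₂ (ends e) ≟ᶠ x) t≡x)) (∨-zeroʳ _)

  joins-sym : ∀ {e x y} → Joins G e x y → Joins G e y x
  joins-sym (inj₁ ends≡) = inj₂ ends≡
  joins-sym (inj₂ ends≡) = inj₁ ends≡

  joins-unique : ∀ {e x y x′ y′} → Joins G e x y → Joins G e x′ y′ → (x ≡ x′ × y ≡ y′) ⊎ (x ≡ y′ × y ≡ x′)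
  joins-unique (inj₁ (p , q)) (inj₁ (p′ , q′)) = inj₁ (trans (sym p) p′ , trans (sym q) q′)
  joins-unique (inj₁ (p , q)) (inj₂ (p′ , q′)) = inj₂ (trans (sym p) p′ , trans (sym q) q′)
  joins-unique (inj₂ (p , q)) (inj₁ (p′ , q′)) = inj₂ (trans (sym q) q′ , trans (sym p) p′)
  joins-unique (inj₂ (p , q)) (inj₂ (p′ , q′)) = inj₁ (trans (sym q) q′ , trans (sym p) p′)

  joins-irrefl : ∀ {e x} → ¬ Joins G e x x
  joins-irrefl {e} (inj₁ (p , q)) = loopless e (trans p (sym q))
  joins-irrefl {e} (inj₂ (p , q)) = loopless e (trans p (sym q))

  other : Fin m → Fin n → Fin n
  other e v with proj₁ (ends e) ≟ᶠ v
  ... | yes _ = proj₂ (ends e)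
  ... | no  _ = proj₁ (ends e)

  joins-other : ∀ {e v} → inc G e v ≡ true → Joins G e v (other e v)
  joins-other {e} {v} ie with proj₁ (ends e) ≟ᶠ v | ∨-true ⌊ proj₁ (ends e) ≟ᶠ v ⌋ ie
  ... | yes s≡v | _     = inj₁ (s≡v , refl)
  ... | no  _   | inj₂ t≡v = inj₂ (refl , isYes-true⁻¹ (proj₂ (ends e) ≟ᶠ v) t≡v)

  module _ {X : EdgeSet G} where
    Reach-snoc : ∀ {u w v} e → e ∈ X → Joins G e w v → Reach G X u w → Reach G X u v
    Reach-snoc e e∈X e-joins here                = step e e∈X e-joins here
    Reach-snoc e e∈X e-joins (step e′ e′∈X j r) = step e′ e′∈X j (Reach-snoc e e∈X e-joins r)

    Reach-sym : ∀ {u v} → Reach G X u v → Reach G X v u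
    Reach-sym here                 = here
    Reach-sym (step e e∈X j r)     = Reach-snoc e e∈X (joins-sym j) (Reach-sym r)

    Reach-trans : ∀ {u w v} → Reach G X u w → Reach G X w v → Reach G X u v
    Reach-trans here             r′ = r′
    Reach-trans (step e e∈X j r) r′ = step e e∈X j (Reach-trans r r′)

module _ (G : Multigraph) (X : EdgeSet G) where
  open Multigraph G

  record NonBacktrackingWalk : Set where
    field
      V               : ℕ → Fin n
      E               : ℕ → Fin m
      E∈X             : ∀ p → E p ∈ X
      E-joins         : ∀ p → Joins G (E p) (V p) (V (suc p))
      nonBacktracking : ∀ p → E (suc p) ≢ E p

  drop : NonBacktrackingWalk → ℕ → NonBacktrackingWalk
  drop W i = record
    { V               = λ p → V (i + p)
    ; E               = λ p → E (i + p)
    ; E∈X             = λ p → E∈X (i + p)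
    ; E-joins         = λ p → subst (Joins G (E (i + p)) (V (i + p))) (cong V (sym (+-suc i p))) (E-joins (i + p))
    ; nonBacktracking = λ p → subst (λ j → E j ≢ E (i + p)) (sym (+-suc i p)) (nonBacktracking (i + p))
    }
    where open NonBacktrackingWalk W

  closedWalk⇒circuit : (W : NonBacktrackingWalk) → let open NonBacktrackingWalk W in
    ∀ ℓ → 1 ≤ ℓ → V ℓ ≡ V 0 → (∀ p q → p < ℓ → q < ℓ → V p ≡ V q → p ≡ q) → Circuit G X ℓ
  closedWalk⇒circuit W ℓ 1≤ℓ closed V-inj = record
    { two≤ℓ  = 2≤ℓ
    ; vtx    = V ∘ toℕ
    ; edg    = E ∘ toℕ
    ; closed = trans (cong V (toℕ-fromℕ ℓ)) closed
    ; inX    = E∈X ∘ toℕ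
    ; joins  = λ i → subst (λ j → Joins G (E (toℕ i)) (V j) (V (suc (toℕ i)))) (sym (toℕ-inject₁ i)) (E-joins (toℕ i))
    ; vtxInj = λ {i} {j} Vi≡Vj → toℕ-injective (begin
        toℕ i             ≡⟨ toℕ-inject₁ i ⟨
        toℕ (inject₁ i)   ≡⟨ V-inj _ _ (inject₁<ℓ i) (inject₁<ℓ j) Vi≡Vj ⟩
        toℕ (inject₁ j)   ≡⟨ toℕ-inject₁ j ⟩
        toℕ j             ∎)
    ; edgInj = E-inj
    }
    where
    open NonBacktrackingWalk W
    open ≡-Reasoning
    inject₁<ℓ : (i : Fin ℓ) → toℕ (inject₁ i) < ℓ
    inject₁<ℓ i = subst (_< ℓ) (sym (toℕ-inject₁ i)) (toℕ<n i)

    2≤ℓ : 2 ≤ ℓ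
    2≤ℓ with m≤n⇒m<n∨m≡n 1≤ℓ
    ... | inj₁ 1<ℓ  = 1<ℓ
    ... | inj₂ refl = contradiction (subst (Joins G (E 0) (V 0)) closed (E-joins 0)) (joins-irrefl G)

    -- Reversing along a repeated edge would close the walk early, except when
    -- the repetition is immediate, which the walk forbids.
    E-distinct : ∀ a b → a < b → b < ℓ → E a ≢ E b
    E-distinct a b a<b b<ℓ Ea≡Eb with joins-unique G (E-joins a) (subst (λ e → Joins G e (V b) (V (suc b))) (sym Ea≡Eb) (E-joins b))
    ... | inj₁ (Va≡Vb , _) = <⇒≢ a<b (V-inj a b (<-trans a<b b<ℓ) b<ℓ Va≡Vb)
    ... | inj₂ (Va≡Vb+1 , Va+1≡Vb) with m≤n⇒m<n∨m≡n b<ℓ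
    ...   | inj₁ b+1<ℓ = <⇒≢ (<-trans a<b (n<1+n b)) (V-inj a (suc b) (<-trans a<b b<ℓ) b+1<ℓ Va≡Vb+1)
    ...   | inj₂ refl  with V-inj a 0 (<-trans a<b b<ℓ) 1≤ℓ (trans Va≡Vb+1 closed)
    ...     | refl     with V-inj 1 b (≤-trans (s≤s a<b) b<ℓ) b<ℓ Va+1≡Vb
    ...       | refl   = nonBacktracking 0 (sym Ea≡Eb)

    E-inj : Injective _≡_ _≡_ (E ∘ toℕ)
    E-inj {i} {j} Ei≡Ej with Fin.<-cmp i j
    ... | tri< i<j _ _ = contradiction Ei≡Ej (E-distinct (toℕ i) (toℕ j) i<j (toℕ<n j))
    ... | tri≈ _ i≡j _ = i≡j
    ... | tri> _ _ j<i = contradiction (sym Ei≡Ej) (E-distinct (toℕ j) (toℕ i) j<i (toℕ<n i))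

  record Arrival : Set where
    constructor arrival
    field
      vertex   : Fin n
      edge     : Fin m
      edge∈X   : lookup X edge ≡ true
      incident : inc G edge vertex ≡ true
  open Arrival

  module _ (minDegree2 : MinDegree2 G X) where
    exit : (a : Arrival) → Σ (Fin m) λ y → y ≢ edge a × lookup X y ∧ inc G y (vertex a) ≡ true
    exit a = another-member (λ y → lookup X y ∧ inc G y (vertex a)) (edge a) (minDegree2 (edge∈X a) (incident a))

    continue : Arrival → Arrival
    continue a = arrival (other G y (vertex a)) y (proj₁ (∧-true y-ok)) (joins⇒inc G (joins-sym G (joins-other G (proj₂ (∧-true y-ok)))))
      where
      y : Fin m
      y = proj₁ (exit a)
      y-ok : lookup X y ∧ inc G y (vertex a) ≡ true
      y-ok = proj₂ (proj₂ (exit a))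

    arrivals : Arrival → ℕ → Arrival
    arrivals a zero    = a
    arrivals a (suc p) = continue (arrivals a p)

    walkFrom : Arrival → NonBacktrackingWalk
    walkFrom a = record
      { V               = vertex ∘ arrivals a
      ; E               = edge ∘ arrivals a ∘ suc
      ; E∈X             = λ p → lookup⇒[]= _ X (edge∈X (arrivals a (suc p)))
      ; E-joins         = λ p → joins-other G (proj₂ (∧-true (proj₂ (proj₂ (exit (arrivals a p))))))
      ; nonBacktracking = λ p → proj₁ (proj₂ (exit (arrivals a (suc p))))
      }

    reach-walk : ∀ a p → Reach G X (vertex a) (NonBacktrackingWalk.V (walkFrom a) p)
    reach-walk a zero    = here
    reach-walk a (suc p) = Reach-snoc G (E p) (E∈X p) (E-joins p) (reach-walk a p)
      where open NonBacktrackingWalk (walkFrom a)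

    reachable-circuit : ∀ {r e} → lookup X e ≡ true → inc G e r ≡ true →
      Σ ℕ λ ℓ → Σ (Circuit G X ℓ) λ C → ∀ j → Reach G X r (Circuit.vtx C j)
    reachable-circuit {r} {e} e∈X ie with firstRepetition (vertex ∘ arrivals (arrival r e e∈X ie))
    ... | i , J , i<J , Vi≡VJ , V-inj = ℓ , circuit , λ j → reach-walk a (i + toℕ j)
      where
      a : Arrival
      a = arrival r e e∈X ie
      W : NonBacktrackingWalk
      W = walkFrom a
      open NonBacktrackingWalk W
      ℓ : ℕ
      ℓ = J ∸ i
      i+ℓ≡J : i + ℓ ≡ J
      i+ℓ≡J = m+[n∸m]≡n (<⇒≤ i<J)
      i+<J : ∀ {p} → p < ℓ → i + p < J
      i+<J p<ℓ = subst (_ <_) i+ℓ≡J (+-monoʳ-< i p<ℓ)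
      circuit : Circuit G X ℓ
      circuit = closedWalk⇒circuit (drop W i) ℓ (m<n⇒0<n∸m i<J)
        (trans (cong V i+ℓ≡J) (trans (sym Vi≡VJ) (cong V (sym (+-identityʳ i)))))
        (λ p q p<ℓ q<ℓ Vi+p≡Vi+q → +-cancelˡ-≡ i p q (V-inj (i + p) (i + q) (i+<J p<ℓ) (i+<J q<ℓ) Vi+p≡Vi+q))

-- Girth and vertex counts

Respects≗ : ∀ {a b} → ((Fin a → Fin b) → Set) → Set
Respects≗ P = ∀ f g → (∀ x → f x ≡ g x) → P f → P g

∃-function? : ∀ a {b} (P : (Fin a → Fin b) → Set) → (∀ f → Dec (P f)) → Respects≗ P → Dec (Σ (Fin a → Fin b) P)
∃-function? zero P P? P-resp with P? (λ ())
... | yes P[] = yes (_ , P[])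
... | no ¬P[] = no λ (f , Pf) → ¬P[] (P-resp f _ (λ ()) Pf)
∃-function? (suc a) {b} P P? P-resp with Fin.any? (λ (x : Fin b) → ∃-function? a (P ∘ cons x) (P? ∘ cons x) (λ f g f≗g → P-resp _ _ (cons-≗ x f≗g)))
  where
  cons : Fin b → (Fin a → Fin b) → Fin (suc a) → Fin b
  cons x f zero    = x
  cons x f (suc y) = f y
  cons-≗ : ∀ x {f g} → (∀ y → f y ≡ g y) → ∀ y → cons x f y ≡ cons x g y
  cons-≗ x f≗g zero    = refl
  cons-≗ x f≗g (suc y) = f≗g y
... | yes (x , f , Pxf) = yes (_ , Pxf)
... | no ¬∃             = no λ (f , Pf) → ¬∃ (f zero , f ∘ suc , P-resp f _ (λ { zero → refl ; (suc y) → refl }) Pf)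

injective? : ∀ {a b} (h : Fin a → Fin b) → Dec (Injective _≡_ _≡_ h)
injective? h = map′ (λ inj {x} {y} → inj x y) (λ inj x y → inj {x} {y})
  (Fin.all? (λ x → Fin.all? (λ y → (h x ≟ᶠ h y) →-dec (x ≟ᶠ y))))

injective-≗ : ∀ {a b} {h h′ : Fin a → Fin b} → (∀ x → h x ≡ h′ x) → Injective _≡_ _≡_ h → Injective _≡_ _≡_ h′
injective-≗ h≗h′ h-inj {x} {y} e = h-inj (trans (h≗h′ x) (trans e (sym (h≗h′ y))))

module _ (G : Multigraph) (X : EdgeSet G) where
  open Multigraph G

  -- The fields of Circuit as a tuple, so that deciding them is componentwise.
  CircuitOn : ∀ ℓ → (Fin (suc ℓ) → Fin n) → (Fin ℓ → Fin m) → Set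
  CircuitOn ℓ vtx edg = (2 ≤ ℓ) × (vtx (fromℕ ℓ) ≡ vtx zero) × (∀ i → edg i ∈ X)
    × (∀ i → Joins G (edg i) (vtx (inject₁ i)) (vtx (suc i)))
    × Injective _≡_ _≡_ (vtx ∘ inject₁) × Injective _≡_ _≡_ edg

  joins? : ∀ e x y → Dec (Joins G e x y)
  joins? e x y = ((proj₁ (ends e) ≟ᶠ x) ×-dec (proj₂ (ends e) ≟ᶠ y)) ⊎-dec ((proj₁ (ends e) ≟ᶠ y) ×-dec (proj₂ (ends e) ≟ᶠ x))

  circuitOn? : ∀ ℓ vtx edg → Dec (CircuitOn ℓ vtx edg)
  circuitOn? ℓ vtx edg = (2 ≤? ℓ) ×-dec (vtx (fromℕ ℓ) ≟ᶠ vtx zero) ×-dec Fin.all? (λ i → edg i ∈? X)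
    ×-dec Fin.all? (λ i → joins? (edg i) (vtx (inject₁ i)) (vtx (suc i))) ×-dec injective? (vtx ∘ inject₁) ×-dec injective? edg

  circuitOn-resp-edg : ∀ ℓ vtx → Respects≗ (CircuitOn ℓ vtx)
  circuitOn-resp-edg ℓ vtx edg edg′ e≗ (2≤ℓ , closed , inX , joins , vtx-inj , edg-inj) =
    2≤ℓ , closed , (λ i → subst (_∈ X) (e≗ i) (inX i)) , (λ i → subst (λ e → Joins G e _ _) (e≗ i) (joins i)) ,
    vtx-inj , injective-≗ e≗ edg-inj

  circuitOn-resp-vtx : ∀ ℓ → Respects≗ (λ vtx → Σ (Fin ℓ → Fin m) (CircuitOn ℓ vtx))
  circuitOn-resp-vtx ℓ vtx vtx′ v≗ (edg , 2≤ℓ , closed , inX , joins , vtx-inj , edg-inj) =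
    edg , 2≤ℓ , trans (sym (v≗ _)) (trans closed (v≗ _)) , inX , (λ i → subst₂ (Joins G (edg i)) (v≗ _) (v≗ _) (joins i)) ,
    injective-≗ (v≗ ∘ inject₁) vtx-inj , edg-inj

  circuit? : ∀ ℓ → Dec (Circuit G X ℓ)
  circuit? ℓ = map′ toCircuit fromCircuit
    (∃-function? (suc ℓ) _ (λ vtx → ∃-function? ℓ (CircuitOn ℓ vtx) (circuitOn? ℓ vtx) (circuitOn-resp-edg ℓ vtx)) (circuitOn-resp-vtx ℓ))
    where
    toCircuit : Σ (Fin (suc ℓ) → Fin n) (λ vtx → Σ (Fin ℓ → Fin m) (CircuitOn ℓ vtx)) → Circuit G X ℓ
    toCircuit (vtx , edg , 2≤ℓ , closed , inX , joins , vtx-inj , edg-inj) = record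
      { two≤ℓ = 2≤ℓ ; vtx = vtx ; edg = edg ; closed = closed ; inX = inX ; joins = joins ; vtxInj = vtx-inj ; edgInj = edg-inj }
    fromCircuit : Circuit G X ℓ → Σ (Fin (suc ℓ) → Fin n) (λ vtx → Σ (Fin ℓ → Fin m) (CircuitOn ℓ vtx))
    fromCircuit C = vtx , edg , two≤ℓ , closed , inX , joins , vtxInj , edgInj
      where open Circuit C

  girth-exists : ∀ {L} → Circuit G X L → Σ ℕ λ g → IsGirth G X g × g ≤ L
  girth-exists {L} C with leastWitness circuit? C
  ... | g , Cg , shortest = g , (Cg , λ ℓ Cℓ → ≮⇒≥ (λ ℓ<g → shortest ℓ ℓ<g Cℓ)) , ≮⇒≥ (λ L<g → shortest L L<g C)

  edge⇒vertex : ∀ {v x} → lookup X x ≡ true → inc G x v ≡ true → lookup (verticesOf G X) v ≡ true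
  edge⇒vertex {v} {x} x∈X ix = trans (lookup∘tabulate _ v) (isYes-true (1 ≤? ∣ X ∩ incSet G v ∣)
    (≤-trans (member⇒1≤degree G x∈X ix) (≤-reflexive (sym (∣∩incSet∣≡degree G X v)))))

  vertex⇒edge : ∀ {v} → lookup (verticesOf G X) v ≡ true → Σ (Fin m) λ x → lookup X x ≡ true × inc G x v ≡ true
  vertex⇒edge {v} v∈V = let x , x-ok = 1≤sum-𝟙⇒∃ (λ y → lookup X y ∧ inc G y v) 1≤deg in x , ∧-true x-ok
    where
    1≤deg : 1 ≤ degree G (lookup X) v
    1≤deg = ≤-trans (isYes-true⁻¹ (1 ≤? ∣ X ∩ incSet G v ∣) (trans (sym (lookup∘tabulate _ v)) v∈V)) (≤-reflexive (∣∩incSet∣≡degree G X v))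

  circuit-vertex : ∀ {ℓ} (C : Circuit G X ℓ) i → lookup (verticesOf G X) (Circuit.vtx C (inject₁ i)) ≡ true
  circuit-vertex C i = edge⇒vertex ([]=⇒lookup (Circuit.inX C i)) (joins⇒inc G (Circuit.joins C i))

  circuit-length≤∣V∣ : ∀ {ℓ} → Circuit G X ℓ → ℓ ≤ ∣ verticesOf G X ∣
  circuit-length≤∣V∣ C = injection⇒≤∣∣ (verticesOf G X) (Circuit.vtx C ∘ inject₁) (Circuit.vtxInj C) (circuit-vertex C)

  separatedCircuits⇒≤∣V∣ : ∀ {c g} (r : Fin c → Fin n) → (∀ i i′ → i ≢ i′ → ¬ Reach G X (r i) (r i′)) →
    (ℓ : Fin c → ℕ) (C : ∀ i → Circuit G X (ℓ i)) → (∀ i j → Reach G X (r i) (Circuit.vtx (C i) j)) →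
    (∀ i → g ≤ ℓ i) → c * g ≤ ∣ verticesOf G X ∣
  separatedCircuits⇒≤∣V∣ {c} {g} r apart ℓ C reaches g≤ℓ =
    injection⇒≤∣∣ (verticesOf G X) (uncurry point ∘ remQuot g)
      (λ {z} {z′} eq → remQuot-injective {z} {z′} (point-inj eq))
      (λ z → let i , j = remQuot {c} g z in circuit-vertex (C i) (inject≤ j (g≤ℓ i)))
    where
    point : Fin c → Fin g → Fin n
    point i j = Circuit.vtx (C i) (inject₁ (inject≤ j (g≤ℓ i)))
    point-inj : ∀ {p q} → uncurry point p ≡ uncurry point q → p ≡ q
    point-inj {i , j} {i′ , j′} eq with i ≟ᶠ i′
    ... | yes refl = cong (i ,_) (inject≤-injective (g≤ℓ i) (g≤ℓ i) j j′ (Circuit.vtxInj (C i) eq))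
    ... | no i≢i′  = contradiction (Reach-trans G (reaches i _) (Reach-sym G (subst (Reach G X (r i′)) (sym eq) (reaches i′ _))))
                                   (apart i i′ i≢i′)
    remQuot-injective : ∀ {z z′} → remQuot {c} g z ≡ remQuot g z′ → z ≡ z′
    remQuot-injective {z} {z′} eq = trans (sym (combine-remQuot {c} g z)) (trans (cong (uncurry combine) eq) (combine-remQuot {c} g z′))

  components*girth≤∣V∣ : MinDegree2 G X → ∀ {g c} → IsGirth G X g → HasComponents G X c → c * g ≤ ∣ verticesOf G X ∣
  components*girth≤∣V∣ minDegree2 (_ , shortest) (r , r∈V , apart , _) =
    separatedCircuits⇒≤∣V∣ r apart (proj₁ ∘ found) (proj₁ ∘ proj₂ ∘ found) (proj₂ ∘ proj₂ ∘ found)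
      (λ i → shortest _ (proj₁ (proj₂ (found i))))
    where
    found : ∀ i → Σ ℕ λ ℓ → Σ (Circuit G X ℓ) λ C → ∀ j → Reach G X (r i) (Circuit.vtx C j)
    found i = let x , x∈X , ix = vertex⇒edge ([]=⇒lookup (r∈V i)) in reachable-circuit G X minDegree2 x∈X ix

  girth≤∣V∣ : MinDegree2 G X → ∀ {e} → lookup X e ≡ true → Σ ℕ λ g → IsGirth G X g × g ≤ ∣ verticesOf G X ∣
  girth≤∣V∣ minDegree2 e∈X =
    let L , C , _ = reachable-circuit G X minDegree2 e∈X (joins⇒inc G (inj₁ (refl , refl)))
        g , girth , g≤L = girth-exists C
    in g , girth , ≤-trans g≤L (circuit-length≤∣V∣ C)

mainTheorem3 : (G : Multigraph) → Cubic G →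
    (M₁ M₂ M₃ : EdgeSet G) →
    IsOneFactor G M₁ → IsOneFactor G M₂ → IsOneFactor G M₃ →
    M₁ ≢ M₂ → M₁ ≢ M₃ → M₂ ≢ M₃ →
    (k : ℕ) → ∣ uncovered G M₁ M₂ M₃ ∣ ≡ k →
    (k < 3 → ThreeEdgeColorable G)
    × (∣ verticesOf G (coreEdges G M₁ M₂ M₃) ∣ + 2 * ∣ (M₁ ∩ M₂) ∩ M₃ ∣ ≡ 2 * k)
    × (∣ coreEdges G M₁ M₂ M₃ ∣ + ∣ (M₁ ∩ M₂) ∩ M₃ ∣ ≡ 2 * k)
    × (1 ≤ k → Σ ℕ (λ g → IsGirth G (coreEdges G M₁ M₂ M₃) g × g ≤ 2 * k))
    × (∀ g c → IsGirth G (coreEdges G M₁ M₂ M₃) g →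
         HasComponents G (coreEdges G M₁ M₂ M₃) c → c * g ≤ 2 * k)
mainTheorem3 G cubic M₁ M₂ M₃ M₁-factor M₂-factor M₃-factor _ _ _ k ∣U∣≡k =
  (λ k<3 → colorable (subst (_< 3) (trans (sym ∣U∣≡k) ∣uncovered∣≡count) k<3)) ,
  vertices≡2k ,
  trans core-edges (cong (2 *_) ∣U∣≡k) ,
  (λ 1≤k → let e , e∈U = 1≤sum-𝟙⇒∃ (lookup U) (subst (1 ≤_) (trans (sym ∣U∣≡k) (∣p∣≡sum U)) 1≤k)
               g , girth , g≤∣V∣ = girth≤∣V∣ G C core-minDegree2 (uncovered⊆core e∈U)
           in g , girth , ≤-trans g≤∣V∣ ∣V∣≤2k) ,
  (λ g c girth components → ≤-trans (components*girth≤∣V∣ G C core-minDegree2 girth components) ∣V∣≤2k)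
  where
  open Core G cubic M₁ M₂ M₃ M₁-factor M₂-factor M₃-factor
  U C : EdgeSet G
  U = uncovered G M₁ M₂ M₃
  C = coreEdges G M₁ M₂ M₃
  vertices≡2k : ∣ verticesOf G C ∣ + 2 * ∣ (M₁ ∩ M₂) ∩ M₃ ∣ ≡ 2 * k
  vertices≡2k = trans core-vertices (cong (2 *_) ∣U∣≡k)
  ∣V∣≤2k : ∣ verticesOf G C ∣ ≤ 2 * k
  ∣V∣≤2k = ≤-trans (m≤m+n _ _) (≤-reflexive vertices≡2k)
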